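{- Let $m\in\mathbb{N}_{+}$ and $A=\{1,2,\ldots,m\}$. Then for all $k,n\in\mathbb{N}$ we have $(-1)^{n}S_{A,k}(n)\geq0$.
   Context: For $A\subseteq\mathbb{N}_{+}$, $c_A(i,n)$ denotes the number of partitions of $n\in\mathbb{N}$ into exactly $i$ parts, all lying in $A$ (order of parts disregarded; $c_A(0,0)=1$), and for $k\in\mathbb{N}$, $S_{A,k}(n)=\sum_{i=0}^{n}(-1)^{i}i^{k}c_A(i,n)$ (with the convention $0^0=1$). -}

module Defs where

open import Data.Nat using (ℕ; zero; suc; _+_; _*_; _^_; _≟_)
open import Data.Integer using (ℤ; +_; -_)
import Data.Integer as ℤ
open import Data.List using (List; []; _∷_; map; concatMap; filter; length; upTo)
open import Data.Nat.ListAction using (sum)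

-- Weakly decreasing lists of length i, all entries in {1, …, b}
-- (i.e. multisets of size i from {1,…,b}, listed in non-increasing order).
decLists : (b i : ℕ) → List (List ℕ)
decLists b zero = [] ∷ []
decLists zero (suc i) = []
decLists (suc b) (suc i) =
  -- largest part is either b+1, or all parts ≤ b
  map (suc b ∷_) (decLists (suc b) i) Data.List.++ decLists b (suc i)

partitionsA : (m i n : ℕ) → List (List ℕ)
partitionsA m i n = filter (λ p → sum p ≟ n) (decLists m i)

c : (m i n : ℕ) → ℕ
c m i n = length (partitionsA m i n)

sgn : ℕ → ℤ
sgn zero = + 1
sgn (suc i) = ℤ.- sgn i

-- S_{A,k}(n) = Σ_{i=0}^{n} (-1)^i i^k c_A(i,n), with 0^0 = 1 (as in ℕ's _^_)
S : (m k n : ℕ) → ℤ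
S m k n = Data.List.foldr ℤ._+_ (+ 0)
  (map (λ i → sgn i ℤ.* (+ (i ^ k * c m i n))) (upTo (suc n)))

-- Substitute q ↦ −q, w ↦ −w in Π_{p ≤ m} 1/(1 − w qᵖ) = Σ c_A(i,n) wⁱ qⁿ and let w act on test
-- functions by wⁱβ = β(· + i). Then (−1)ⁿ S_{A,k}(n) is the coefficient of qⁿ in
-- Π_{p ≤ m} 1/(1 − (−1)^(p+1) w qᵖ) applied to β(L) = Lᵏ, at L = 0.
-- Lᵏ is absolutely monotone (all its forward differences are ≥ 0), so it suffices that the
-- product maps absolutely monotone functions to nonnegative ones; as the factors commute we may
-- group the parts into chains o, 2o, …, 2ᵉo with o odd. For y = w qᵒ the factor 1/(1 − y) is
-- positive and (1 − y²)/(1 − y) = 1 + y is too. Doubling the top part e of a chain contributes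
-- 1/(1 + w q^(2e)) = (1 − w q^(2e)) / (1 − w² q^(4e)), and the numerator applied to the shorter
-- chain V is (1 − w² q^(2e))V + w (w − 1) q^(2e) V ≥ 0, where the first summand is the invariant
-- (1 − (w qᵉ)²)V ≥ 0 carried along the chain and the second is a shifted difference of V.
module Submission where

open import Defs
open import Data.Nat as ℕ using (ℕ; zero; suc; _∸_; _^_; z≤n; s≤s)
import Data.Nat.Properties as ℕₚ
open import Data.Nat.Induction using (<-rec)
open import Data.Nat.ListAction using (sum)
open import Data.Integer using (ℤ; +_; -_; _+_; _*_; _-_; _≤_; +≤+)
import Data.Integer.Properties as ℤₚ
open import Data.Integer.Tactic.RingSolver using (solve-∀)
open import Data.List using (List; []; _∷_; _++_; foldr; downFrom; map; filter; length; applyUpTo)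
import Data.List.Properties as Listₚ
open import Data.List.Relation.Binary.Permutation.Propositional as ↭ using (_↭_)
open import Data.List.Relation.Binary.Permutation.Propositional.Properties using (++-comm)
open import Data.Product using (_×_; _,_; proj₁; proj₂; Σ-syntax)
open import Data.Sum using (_⊎_; inj₁; inj₂)
open import Relation.Nullary using (Dec; yes; no; contradiction)
open import Relation.Binary.PropositionalEquality

<-or-+ : ∀ j n → n ℕ.< j ⊎ Σ[ i ∈ ℕ ] n ≡ i ℕ.+ j
<-or-+ j n with j ℕₚ.≤? n
... | yes j≤n = inj₂ (n ∸ j , sym (ℕₚ.m∸n+n≡m j≤n))
... | no  j≰n = inj₁ (ℕₚ.≰⇒> j≰n)

+-*-zeroʳ : ∀ x s → x + s * + 0 ≡ x
+-*-zeroʳ x s = trans (cong (_+_ x) (ℤₚ.*-zeroʳ s)) (ℤₚ.+-identityʳ x)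

double : ℕ → ℕ
double zero    = zero
double (suc k) = suc (suc (double k))

double-+ : ∀ k → double k ≡ k ℕ.+ k
double-+ zero    = refl
double-+ (suc k) = cong suc (trans (cong suc (double-+ k)) (sym (ℕₚ.+-suc k k)))

≤-double : ∀ k → k ℕ.≤ double k
≤-double k = subst (k ℕ.≤_) (sym (double-+ k)) (ℕₚ.m≤m+n k k)

sgn-+ : ∀ a b → sgn (a ℕ.+ b) ≡ sgn a * sgn b
sgn-+ zero    b = sym (ℤₚ.*-identityˡ (sgn b))
sgn-+ (suc a) b = trans (cong -_ (sgn-+ a b)) (ℤₚ.neg-distribˡ-* (sgn a) (sgn b))

sgn-double : ∀ k → sgn (double k) ≡ + 1
sgn-double zero    = refl
sgn-double (suc k) rewrite sgn-double k = refl

sgn-*-sgn : ∀ a → sgn a * sgn a ≡ + 1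
sgn-*-sgn a = trans (sym (sgn-+ a a)) (trans (cong sgn (sym (double-+ a))) (sgn-double a))

-- A series X stands for Σₙ qⁿ Σᵢ aₙᵢ wⁱ with X n L = Σᵢ aₙᵢ β(L + i) for a test function β;
-- so w acts as L ↦ suc L, and  shift j  is multiplication by w qʲ.
Series : Set
Series = ℕ → ℕ → ℤ

_≈_ : Series → Series → Set
X ≈ Y = ∀ n L → X n L ≡ Y n L

Nonneg : Series → Set
Nonneg X = ∀ n L → + 0 ≤ X n L

NonnegBelow : ℕ → Series → Set
NonnegBelow n X = ∀ m → m ℕ.< n → ∀ L → + 0 ≤ X m L

shift : ℕ → Series → Series
shift j X n L with j ℕₚ.≤? n
... | yes _ = X (n ∸ j) (suc L)
... | no  _ = + 0

shift-< : ∀ j X {n} L → n ℕ.< j → shift j X n L ≡ + 0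
shift-< j X {n} L n<j with j ℕₚ.≤? n
... | yes j≤n = contradiction j≤n (ℕₚ.<⇒≱ n<j)
... | no  _   = refl

shift-≤ : ∀ j X {n} L → j ℕ.≤ n → shift j X n L ≡ X (n ∸ j) (suc L)
shift-≤ j X {n} L j≤n with j ℕₚ.≤? n
... | yes _   = refl
... | no  j≰n = contradiction j≤n j≰n

shift-+ : ∀ j X n L → shift j X (n ℕ.+ j) L ≡ X n (suc L)
shift-+ j X n L = trans (shift-≤ j X L (ℕₚ.m≤n+m j n)) (cong (λ m → X m (suc L)) (ℕₚ.m+n∸n≡m n j))

shift-cong-at : ∀ j X Y n L → (j ℕ.≤ n → X (n ∸ j) (suc L) ≡ Y (n ∸ j) (suc L)) →
                shift j X n L ≡ shift j Y n L
shift-cong-at j X Y n L eq with j ℕₚ.≤? n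
... | yes j≤n = eq j≤n
... | no  _   = refl

shift-cong : ∀ j {X Y} → X ≈ Y → shift j X ≈ shift j Y
shift-cong j {X} {Y} X≈Y n L = shift-cong-at j X Y n L (λ _ → X≈Y _ _)

shift-linear : ∀ j X Y s → shift j (λ n L → X n L + s * Y n L) ≈ λ n L → shift j X n L + s * shift j Y n L
shift-linear j X Y s n L with j ℕₚ.≤? n
... | yes _ = refl
... | no  _ = sym (+-*-zeroʳ (+ 0) s)

shift-shift : ∀ i j X → shift i (shift j X) ≈ shift (i ℕ.+ j) (λ n L → X n (suc L))
shift-shift i j X n L with i ℕₚ.≤? n
... | no i≰n = sym (shift-< (i ℕ.+ j) _ L (ℕₚ.<-≤-trans (ℕₚ.≰⇒> i≰n) (ℕₚ.m≤m+n i j)))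
... | yes i≤n with j ℕₚ.≤? n ∸ i
...   | yes j≤n∸i = sym (trans (shift-≤ (i ℕ.+ j) _ L i+j≤n)
                              (cong (λ m → X m (suc (suc L))) (sym (ℕₚ.∸-+-assoc n i j))))
  where
  i+j≤n : i ℕ.+ j ℕ.≤ n
  i+j≤n = subst (i ℕ.+ j ℕ.≤_) (ℕₚ.m+[n∸m]≡n i≤n) (ℕₚ.+-monoʳ-≤ i j≤n∸i)
...   | no  j≰n∸i = sym (shift-< (i ℕ.+ j) _ L n<i+j)
  where
  n<i+j : n ℕ.< i ℕ.+ j
  n<i+j = subst (ℕ._< i ℕ.+ j) (ℕₚ.m+[n∸m]≡n i≤n) (ℕₚ.+-monoʳ-< i (ℕₚ.≰⇒> j≰n∸i))

shift-comm : ∀ i j X → shift i (shift j X) ≈ shift j (shift i X)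
shift-comm i j X n L = begin
  shift i (shift j X) n L         ≡⟨ shift-shift i j X n L ⟩
  shift (i ℕ.+ j) wX n L          ≡⟨ cong (λ k → shift k wX n L) (ℕₚ.+-comm i j) ⟩
  shift (j ℕ.+ i) wX n L          ≡⟨ shift-shift j i X n L ⟨
  shift j (shift i X) n L         ∎
  where
  open ≡-Reasoning
  wX : Series
  wX n L = X n (suc L)

shift-nonneg : ∀ j {X} → Nonneg X → Nonneg (shift j X)
shift-nonneg j X≥0 n L with j ℕₚ.≤? n
... | yes _ = X≥0 _ _
... | no  _ = +≤+ z≤n

shift-nonnegBelow : ∀ j {X n} → NonnegBelow n X → NonnegBelow (suc n) (shift (suc j) X)
shift-nonnegBelow j X≥0 m m≤n L with suc j ℕₚ.≤? m
... | yes (s≤s _) = X≥0 (m ∸ suc j) (ℕₚ.<-≤-trans (s≤s (ℕₚ.m∸n≤m _ j)) (ℕₚ.≤-pred m≤n)) (suc L)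
... | no  _       = +≤+ z≤n

nonneg-recurrence : (X Y R : Series) → X ≈ (λ n L → Y n L + R n L) → Nonneg Y →
                    (∀ n → NonnegBelow n X → ∀ L → + 0 ≤ R n L) → Nonneg X
nonneg-recurrence X Y R eq Y≥0 R≥0 = <-rec (λ n → ∀ L → + 0 ≤ X n L)
  λ n ih L → subst (+ 0 ≤_) (sym (eq n L)) (ℤₚ.+-mono-≤ (Y≥0 n L) (R≥0 n (λ m → ih) L))

-- The part 1 + a contributes the factor 1/(1 − (−1)ᵃ w q^(1+a)).
GeometricEq : ℕ → Series → Series → Set
GeometricEq a γ X = X ≈ λ n L → γ n L + sgn a * shift (suc a) X n L

-- The first f + 1 terms of the geometric series; exact in every degree n ≤ f.
geometricᶠ : ℕ → ℕ → Series → Series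
geometricᶠ zero    a γ = γ
geometricᶠ (suc f) a γ n L = γ n L + sgn a * shift (suc a) (geometricᶠ f a γ) n L

geometric : ℕ → Series → Series
geometric a γ n L = geometricᶠ n a γ n L

geometricᶠ-fuel : ∀ a γ {f g n} L → n ℕ.≤ f → n ℕ.≤ g →
                  geometricᶠ f a γ n L ≡ geometricᶠ g a γ n L
geometricᶠ-fuel a γ {zero}  {zero}  L _ _ = refl
geometricᶠ-fuel a γ {zero}  {suc g} L z≤n _ = sym (+-*-zeroʳ (γ 0 L) (sgn a))
geometricᶠ-fuel a γ {suc f} {zero}  L _ z≤n = +-*-zeroʳ (γ 0 L) (sgn a)
geometricᶠ-fuel a γ {suc f} {suc g} {n} L n≤f n≤g =
  cong (λ z → γ n L + sgn a * z) (shift-cong-at (suc a) _ _ n L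
    (λ _ → geometricᶠ-fuel a γ (suc L) (∸-suc-≤ n≤f) (∸-suc-≤ n≤g)))
  where
  ∸-suc-≤ : ∀ {n f} → n ℕ.≤ suc f → n ∸ suc a ℕ.≤ f
  ∸-suc-≤ {zero}  _         = z≤n
  ∸-suc-≤ {suc n} (s≤s n≤f) = ℕₚ.≤-trans (ℕₚ.m∸n≤m n a) n≤f

geometric-eq : ∀ a γ → GeometricEq a γ (geometric a γ)
geometric-eq a γ zero    L = sym (+-*-zeroʳ (γ 0 L) (sgn a))
geometric-eq a γ (suc n) L =
  cong (λ z → γ (suc n) L + sgn a * z) (shift-cong-at (suc a) _ _ (suc n) L
    (λ _ → geometricᶠ-fuel a γ (suc L) (ℕₚ.m∸n≤m n a) ℕₚ.≤-refl))

geometric-unique : ∀ a γ X → GeometricEq a γ X → X ≈ geometric a γ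
geometric-unique a γ X eq = <-rec (λ n → ∀ L → X n L ≡ geometric a γ n L) step
  where
  step : ∀ n → (∀ {m} → m ℕ.< n → ∀ L → X m L ≡ geometric a γ m L) → ∀ L → X n L ≡ geometric a γ n L
  step n ih L = begin
    X n L                                             ≡⟨ eq n L ⟩
    γ n L + sgn a * shift (suc a) X n L               ≡⟨ cong (λ z → γ n L + sgn a * z)
                                                           (shift-cong-at (suc a) _ _ n L (λ a<n → ih (∸-< a<n) _)) ⟩
    γ n L + sgn a * shift (suc a) (geometric a γ) n L ≡⟨ geometric-eq a γ n L ⟨
    geometric a γ n L                                 ∎
    where
    open ≡-Reasoning
    ∸-< : ∀ {n} → suc a ℕ.≤ n → n ∸ suc a ℕ.< n
    ∸-< (s≤s a≤n) = s≤s (ℕₚ.m∸n≤m _ a)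

geometric-cong : ∀ a {γ γ′} → γ ≈ γ′ → geometric a γ ≈ geometric a γ′
geometric-cong a {γ} {γ′} γ≈γ′ = geometric-unique a γ′ (geometric a γ)
  (λ n L → trans (geometric-eq a γ n L)
                 (cong (λ z → z + sgn a * shift (suc a) (geometric a γ) n L) (γ≈γ′ n L)))

geometric-inverse : ∀ b X → X ≈ geometric b (λ n L → X n L + (- sgn b) * shift (suc b) X n L)
geometric-inverse b X = geometric-unique b _ X λ n L → cancel (X n L) (sgn b) (shift (suc b) X n L)
  where
  cancel : ∀ x s y → x ≡ (x + (- s) * y) + s * y
  cancel = solve-∀

-- H (1 − s_b y_b) solves the equation of γ/(1 − s_a y_a), so H = (γ/(1 − s_a y_a))/(1 − s_b y_b).
geometric-comm : ∀ a b γ → geometric a (geometric b γ) ≈ geometric b (geometric a γ)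
geometric-comm a b γ n L =
  trans (geometric-inverse b H n L) (geometric-cong b (geometric-unique a γ D D-eq) n L)
  where
  H = geometric a (geometric b γ)
  G = geometric b γ
  D : Series
  D n L = H n L + (- sgn b) * shift (suc b) H n L
  D-eq : GeometricEq a γ D
  D-eq n L = begin
    H n L + (- sb) * shift (suc b) H n L
      ≡⟨ cong₂ (λ h s → h + (- sb) * s) (geometric-eq a G n L) shift-H ⟩
    (G n L + sa * yaH) + (- sb) * (ybG + sa * ybyaH)
      ≡⟨ cong (λ g → (g + sa * yaH) + (- sb) * (ybG + sa * ybyaH)) (geometric-eq b γ n L) ⟩
    ((γ n L + sb * ybG) + sa * yaH) + (- sb) * (ybG + sa * ybyaH)
      ≡⟨ regroup (γ n L) sa sb ybG yaH ybyaH ⟩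
    γ n L + sa * (yaH + (- sb) * ybyaH)
      ≡⟨ cong (λ z → γ n L + sa * (yaH + (- sb) * z)) (shift-comm (suc b) (suc a) H n L) ⟩
    γ n L + sa * (yaH + (- sb) * shift (suc a) (shift (suc b) H) n L)
      ≡⟨ cong (λ z → γ n L + sa * z) (shift-linear (suc a) H (shift (suc b) H) (- sb) n L) ⟨
    γ n L + sa * shift (suc a) D n L ∎
    where
    open ≡-Reasoning
    sa = sgn a
    sb = sgn b
    yaH = shift (suc a) H n L
    ybG = shift (suc b) G n L
    ybyaH = shift (suc b) (shift (suc a) H) n L
    shift-H : shift (suc b) H n L ≡ ybG + sa * ybyaH
    shift-H = trans (shift-cong (suc b) (geometric-eq a G) n L) (shift-linear (suc b) G (shift (suc a) H) sa n L)
    regroup : ∀ g sa sb B A C → ((g + sb * B) + sa * A) + (- sb) * (B + sa * C) ≡ g + sa * (A + (- sb) * C)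
    regroup = solve-∀

-- 1/(1 − s y) = (1 + s y)/(1 − y²) since s² = 1
numerator : ℕ → Series → Series
numerator a γ n L = γ n L + sgn a * shift (suc a) γ n L

oneMinusSquare : ℕ → Series → Series
oneMinusSquare e X n L = X n L - shift e (shift e X) n L

geometric-eq² : ∀ a γ →
  geometric a γ ≈ λ n L → numerator a γ n L + shift (suc a) (shift (suc a) (geometric a γ)) n L
geometric-eq² a γ n L = begin
  X n L                                       ≡⟨ geometric-eq a γ n L ⟩
  γ n L + sgn a * shift (suc a) X n L         ≡⟨ cong (λ z → γ n L + sgn a * z) shift-X ⟩
  γ n L + sgn a * (yγ + sgn a * yyX)          ≡⟨ expand (γ n L) (sgn a) yγ yyX ⟩
  numerator a γ n L + (sgn a * sgn a) * yyX   ≡⟨ cong (λ s → numerator a γ n L + s * yyX) (sgn-*-sgn a) ⟩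
  numerator a γ n L + + 1 * yyX               ≡⟨ cong (_+_ (numerator a γ n L)) (ℤₚ.*-identityˡ yyX) ⟩
  numerator a γ n L + yyX                     ∎
  where
  open ≡-Reasoning
  X = geometric a γ
  yγ = shift (suc a) γ n L
  yyX = shift (suc a) (shift (suc a) X) n L
  shift-X : shift (suc a) X n L ≡ yγ + sgn a * yyX
  shift-X = trans (shift-cong (suc a) (geometric-eq a γ) n L) (shift-linear (suc a) γ (shift (suc a) X) (sgn a) n L)
  expand : ∀ g s u v → g + s * (u + s * v) ≡ (g + s * u) + (s * s) * v
  expand = solve-∀

geometric-nonneg : ∀ a γ → Nonneg (numerator a γ) → Nonneg (geometric a γ)
geometric-nonneg a γ num≥0 = nonneg-recurrence X (numerator a γ) (shift (suc a) (shift (suc a) X))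
  (geometric-eq² a γ) num≥0
  (λ n below → shift-nonnegBelow a (shift-nonnegBelow a below) n (ℕₚ.m≤n⇒m≤1+n (ℕₚ.n<1+n n)))
  where X = geometric a γ

geometric-oneMinusSquare : ∀ a γ → oneMinusSquare (suc a) (geometric a γ) ≈ numerator a γ
geometric-oneMinusSquare a γ n L =
  trans (cong (_- shift (suc a) (shift (suc a) (geometric a γ)) n L) (geometric-eq² a γ n L)) (cancel _ _)
  where
  cancel : ∀ x z → (x + z) - z ≡ x
  cancel = solve-∀

geometrics : List ℕ → Series → Series
geometrics A β = foldr geometric β A

geometrics-++ : ∀ A B β → geometrics (A ++ B) β ≡ geometrics A (geometrics B β)
geometrics-++ A B β = Listₚ.foldr-++ geometric β A B

geometrics-↭ : ∀ {A B} → A ↭ B → ∀ β → geometrics A β ≈ geometrics B β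
geometrics-↭ ↭.refl            β n L = refl
geometrics-↭ (↭.prep a A↭B)    β     = geometric-cong a (geometrics-↭ A↭B β)
geometrics-↭ {a ∷ b ∷ A} (↭.swap a b A↭B) β n L =
  trans (geometric-comm a b (geometrics A β) n L) (geometric-cong b (geometric-cong a (geometrics-↭ A↭B β)) n L)
geometrics-↭ (↭.trans A↭B B↭C) β n L = trans (geometrics-↭ A↭B β n L) (geometrics-↭ B↭C β n L)

-- Absolute monotonicity

δ : (ℕ → ℤ) → ℕ → ℤ
δ g L = g (suc L) - g L

δ^ : ℕ → (ℕ → ℤ) → ℕ → ℤ
δ^ zero    g = g
δ^ (suc r) g = δ^ r (δ g)

δ^-cong : ∀ r {g h} → (∀ L → g L ≡ h L) → ∀ L → δ^ r g L ≡ δ^ r h L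
δ^-cong zero    g≗h = g≗h
δ^-cong (suc r) g≗h = δ^-cong r (λ L → cong₂ _-_ (g≗h (suc L)) (g≗h L))

δ^-+ : ∀ r g h L → δ^ r (λ L → g L + h L) L ≡ δ^ r g L + δ^ r h L
δ^-+ zero    g h L = refl
δ^-+ (suc r) g h L =
  trans (δ^-cong r (λ L → interchange (g (suc L)) (h (suc L)) (g L) (h L)) L) (δ^-+ r (δ g) (δ h) L)
  where
  interchange : ∀ a b c d → (a + b) - (c + d) ≡ (a - c) + (b - d)
  interchange = solve-∀

AbsolutelyMonotone : (ℕ → ℤ) → Set
AbsolutelyMonotone g = ∀ r L → + 0 ≤ δ^ r g L

absolutelyMonotone-δ^ : ∀ r {g} → AbsolutelyMonotone g → AbsolutelyMonotone (δ^ r g)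
absolutelyMonotone-δ^ zero    g-mono = g-mono
absolutelyMonotone-δ^ (suc r) g-mono = absolutelyMonotone-δ^ r (λ s → g-mono (suc s))

absolutelyMonotone-cong : ∀ {g h} → (∀ L → g L ≡ h L) → AbsolutelyMonotone g → AbsolutelyMonotone h
absolutelyMonotone-cong g≗h g-mono r L = subst (+ 0 ≤_) (δ^-cong r g≗h L) (g-mono r L)

absolutelyMonotone-0 : AbsolutelyMonotone (λ _ → + 0)
absolutelyMonotone-0 zero    L = +≤+ z≤n
absolutelyMonotone-0 (suc r) L = absolutelyMonotone-0 r L

+-*-nonneg : ∀ m {x} → + 0 ≤ x → + 0 ≤ + m * x
+-*-nonneg m {+ x} _ = subst (+ 0 ≤_) (ℤₚ.pos-* m x) (+≤+ z≤n)

-- δ((L + c) g) = (L + c + 1) δg + g, and the first summand has the same shape.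
absolutelyMonotone-* : ∀ c {g} → AbsolutelyMonotone g → AbsolutelyMonotone (λ L → + (L ℕ.+ c) * g L)
absolutelyMonotone-* c g-mono zero    L = +-*-nonneg (L ℕ.+ c) (g-mono 0 L)
absolutelyMonotone-* c {g} g-mono (suc r) L =
  subst (+ 0 ≤_) (sym (trans (δ^-cong r leibniz L) (δ^-+ r _ g L)))
    (ℤₚ.+-mono-≤ (absolutelyMonotone-* (suc c) (λ s → g-mono (suc s)) r L) (g-mono r L))
  where
  leibniz : ∀ L → + (suc L ℕ.+ c) * g (suc L) - + (L ℕ.+ c) * g L ≡ + (L ℕ.+ suc c) * δ g L + g L
  leibniz L = begin
    + suc (L ℕ.+ c) * g (suc L) - + (L ℕ.+ c) * g L
      ≡⟨ cong (λ t → t * g (suc L) - + (L ℕ.+ c) * g L) (ℤₚ.pos-+ 1 (L ℕ.+ c)) ⟩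
    (+ 1 + + (L ℕ.+ c)) * g (suc L) - + (L ℕ.+ c) * g L
      ≡⟨ expand (+ (L ℕ.+ c)) (g (suc L)) (g L) ⟩
    (+ 1 + + (L ℕ.+ c)) * δ g L + g L
      ≡⟨ cong (λ t → t * δ g L + g L) (trans (sym (ℤₚ.pos-+ 1 (L ℕ.+ c))) (cong +_ (sym (ℕₚ.+-suc L c)))) ⟩
    + (L ℕ.+ suc c) * δ g L + g L ∎
    where
    open ≡-Reasoning
    expand : ∀ t a b → (+ 1 + t) * a - t * b ≡ (+ 1 + t) * (a - b) + b
    expand = solve-∀

absolutelyMonotone-^ : ∀ k → AbsolutelyMonotone (λ L → + (L ^ k))
absolutelyMonotone-^ zero    zero    L = +≤+ z≤n
absolutelyMonotone-^ zero    (suc r) L = absolutelyMonotone-0 r L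
absolutelyMonotone-^ (suc k) = absolutelyMonotone-cong
  (λ L → trans (cong (λ l → + l * + (L ^ k)) (ℕₚ.+-identityʳ L)) (sym (ℤₚ.pos-* L (L ^ k))))
  (absolutelyMonotone-* 0 (absolutelyMonotone-^ k))

Δ : Series → Series
Δ X n = δ (X n)

shift-Δ : ∀ j X → shift j (Δ X) ≈ Δ (shift j X)
shift-Δ j X n L with j ℕₚ.≤? n
... | yes _ = refl
... | no  _ = refl

shift-Δ′ : ∀ j X n L → shift j (λ n L → X n (suc L)) n L - shift j X n L ≡ shift j (Δ X) n L
shift-Δ′ j X n L with j ℕₚ.≤? n
... | yes _ = refl
... | no  _ = refl

-- 1 − w q^(2e) = (1 − (w qᵉ)²) + w q^(2e) (w − 1)
oneMinusSquare-Δ : ∀ e X n L →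
  X n L - shift (e ℕ.+ e) X n L ≡ oneMinusSquare e X n L + shift (e ℕ.+ e) (Δ X) n L
oneMinusSquare-Δ e X n L = begin
  X n L - shift (e ℕ.+ e) X n L
    ≡⟨ telescope (X n L) (shift e (shift e X) n L) (shift (e ℕ.+ e) X n L) ⟩
  oneMinusSquare e X n L + (shift e (shift e X) n L - shift (e ℕ.+ e) X n L)
    ≡⟨ cong (λ z → oneMinusSquare e X n L + (z - shift (e ℕ.+ e) X n L)) (shift-shift e e X n L) ⟩
  oneMinusSquare e X n L + (shift (e ℕ.+ e) (λ n L → X n (suc L)) n L - shift (e ℕ.+ e) X n L)
    ≡⟨ cong (_+_ (oneMinusSquare e X n L)) (shift-Δ′ (e ℕ.+ e) X n L) ⟩
  oneMinusSquare e X n L + shift (e ℕ.+ e) (Δ X) n L ∎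
  where
  open ≡-Reasoning
  telescope : ∀ x y z → x - z ≡ (x - y) + (y - z)
  telescope = solve-∀

geometric-Δ : ∀ a γ → geometric a (Δ γ) ≈ Δ (geometric a γ)
geometric-Δ a γ n L = sym (geometric-unique a (Δ γ) (Δ X) Δ-eq n L)
  where
  X = geometric a γ
  Δ-eq : GeometricEq a (Δ γ) (Δ X)
  Δ-eq n L = begin
    X n (suc L) - X n L
      ≡⟨ cong₂ _-_ (geometric-eq a γ n (suc L)) (geometric-eq a γ n L) ⟩
    (γ n (suc L) + sgn a * shift (suc a) X n (suc L)) - (γ n L + sgn a * shift (suc a) X n L)
      ≡⟨ distrib (γ n (suc L)) (γ n L) (sgn a) _ _ ⟩
    Δ γ n L + sgn a * Δ (shift (suc a) X) n L
      ≡⟨ cong (λ z → Δ γ n L + sgn a * z) (shift-Δ (suc a) X n L) ⟨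
    Δ γ n L + sgn a * shift (suc a) (Δ X) n L ∎
    where
    open ≡-Reasoning
    distrib : ∀ x y s u v → (x + s * u) - (y + s * v) ≡ (x - y) + s * (u - v)
    distrib = solve-∀

geometrics-δ^ : ∀ r A β → geometrics A (λ n → δ^ r (β n)) ≈ λ n → δ^ r (geometrics A β n)
geometrics-δ^ zero    A β n L = refl
geometrics-δ^ (suc r) A β n L =
  trans (geometrics-δ^ r A (Δ β) n L) (δ^-cong r (geometrics-Δ A β n) L)
  where
  geometrics-Δ : ∀ A β → geometrics A (Δ β) ≈ Δ (geometrics A β)
  geometrics-Δ []      β n L = refl
  geometrics-Δ (a ∷ A) β n L =
    trans (geometric-cong a (geometrics-Δ A β) n L) (geometric-Δ a (geometrics A β) n L)

Positive : List ℕ → Set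
Positive A = ∀ β → (∀ n → AbsolutelyMonotone (β n)) → Nonneg (geometrics A β)

-- Differences commute with the product, so a positive product preserves absolute monotonicity.
positive-absolutelyMonotone : ∀ A → Positive A → ∀ β → (∀ n → AbsolutelyMonotone (β n)) →
                              ∀ n → AbsolutelyMonotone (geometrics A β n)
positive-absolutelyMonotone A pos β β-mono n r L =
  subst (+ 0 ≤_) (geometrics-δ^ r A β n L)
    (pos (λ n → δ^ r (β n)) (λ n → absolutelyMonotone-δ^ r (β-mono n)) n L)

positive-[] : Positive []
positive-[] β β-mono n L = β-mono n 0 L

positive-++ : ∀ A B → Positive A → Positive B → Positive (A ++ B)
positive-++ A B posA posB β β-mono n L =
  subst (+ 0 ≤_) (sym (cong (λ X → X n L) (geometrics-++ A B β)))
    (posA (geometrics B β) (positive-absolutelyMonotone B posB β β-mono) n L)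

positive-↭ : ∀ {A B} → A ↭ B → Positive A → Positive B
positive-↭ A↭B posA β β-mono n L = subst (+ 0 ≤_) (geometrics-↭ A↭B β n L) (posA β β-mono n L)

-- Doubling chains

-- The parts 1 + a, (1 + a)/2, …, down to the odd part of 1 + a; indices are parts minus one.
data Chain : ℕ → Set where
  odd   : ∀ k → Chain (double k)
  twice : ∀ {a} → Chain a → Chain (suc (double a))

indices : ∀ {a} → Chain a → List ℕ
indices (odd k)       = double k ∷ []
indices (twice {a} c) = suc (double a) ∷ indices c

ChainPositive : ℕ → List ℕ → Set
ChainPositive a A = ∀ β → (∀ n → AbsolutelyMonotone (β n)) →
  Nonneg (geometrics A β) × Nonneg (oneMinusSquare (suc a) (geometrics A β))

chainPositive-odd : ∀ k → ChainPositive (double k) (double k ∷ [])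
chainPositive-odd k β β-mono =
  geometric-nonneg (double k) β num≥0 ,
  λ n L → subst (+ 0 ≤_) (sym (geometric-oneMinusSquare (double k) β n L)) (num≥0 n L)
  where
  num≥0 : Nonneg (numerator (double k) β)
  num≥0 n L = subst (λ s → + 0 ≤ β n L + s * shift (suc (double k)) β n L) (sym (sgn-double k))
    (subst (λ x → + 0 ≤ β n L + x) (sym (ℤₚ.*-identityˡ _))
      (ℤₚ.+-mono-≤ (β-mono n 0 L) (shift-nonneg (suc (double k)) (λ n → β-mono n 0) n L)))

chainPositive-twice : ∀ {a A} → ChainPositive a A → ChainPositive (suc (double a)) (suc (double a) ∷ A)
chainPositive-twice {a} {A} chain β β-mono =
  geometric-nonneg a′ V num≥0 ,
  λ n L → subst (+ 0 ≤_) (sym (geometric-oneMinusSquare a′ V n L)) (num≥0 n L)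
  where
  a′ = suc (double a)
  V = geometrics A β
  ΔV≥0 : Nonneg (Δ V)
  ΔV≥0 n L = subst (+ 0 ≤_) (geometrics-δ^ 1 A β n L)
    (proj₁ (chain (Δ β) (λ n → absolutelyMonotone-δ^ 1 (β-mono n))) n L)
  e+e≡1+a′ : suc a ℕ.+ suc a ≡ suc a′
  e+e≡1+a′ = cong suc (trans (ℕₚ.+-suc a a) (cong suc (sym (double-+ a))))
  num≥0 : Nonneg (numerator a′ V)
  num≥0 n L = subst (+ 0 ≤_) num-eq
    (ℤₚ.+-mono-≤ (proj₂ (chain β β-mono) n L) (shift-nonneg (suc a ℕ.+ suc a) ΔV≥0 n L))
    where
    num-eq : oneMinusSquare (suc a) V n L + shift (suc a ℕ.+ suc a) (Δ V) n L ≡ numerator a′ V n L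
    num-eq = begin
      oneMinusSquare (suc a) V n L + shift (suc a ℕ.+ suc a) (Δ V) n L
        ≡⟨ oneMinusSquare-Δ (suc a) V n L ⟨
      V n L - shift (suc a ℕ.+ suc a) V n L
        ≡⟨ cong (λ j → V n L - shift j V n L) e+e≡1+a′ ⟩
      V n L - shift (suc a′) V n L
        ≡⟨ cong (_+_ (V n L)) (ℤₚ.-1*i≡-i _) ⟨
      V n L + - + 1 * shift (suc a′) V n L
        ≡⟨ cong (λ s → V n L + - s * shift (suc a′) V n L) (sgn-double a) ⟨
      numerator a′ V n L ∎
      where open ≡-Reasoning

chainPositive : ∀ {a} (c : Chain a) → ChainPositive a (indices c)
chainPositive (odd k)       = chainPositive-odd k
chainPositive (twice {a} c) = chainPositive-twice {a} {indices c} (chainPositive c)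

-- Cover a b holds one chain with top index j for each a ≤ j < b.
data Cover : ℕ → ℕ → Set where
  []  : ∀ {a} → Cover a a
  _∷_ : ∀ {a b} → Chain a → Cover (suc a) b → Cover a b

_∷ʳ_ : ∀ {a b} → Cover a b → Chain b → Cover a (suc b)
[]       ∷ʳ c = c ∷ []
(d ∷ cs) ∷ʳ c = d ∷ (cs ∷ʳ c)

uncons : ∀ {a b} → a ℕ.< b → Cover a b → Chain a × Cover (suc a) b
uncons a<a []       = contradiction a<a (ℕₚ.<-irrefl refl)
uncons _   (c ∷ cs) = c , cs

coverIndices : ∀ {a b} → Cover a b → List ℕ
coverIndices []       = []
coverIndices (c ∷ cs) = indices c ++ coverIndices cs

coverIndices-∷ʳ : ∀ {a b} (cs : Cover a b) c → coverIndices (cs ∷ʳ c) ≡ coverIndices cs ++ indices c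
coverIndices-∷ʳ []       c = Listₚ.++-identityʳ (indices c)
coverIndices-∷ʳ (d ∷ cs) c =
  trans (cong (indices d ++_) (coverIndices-∷ʳ cs c)) (sym (Listₚ.++-assoc (indices d) _ _))

coverIndices-uncons : ∀ {a b} (a<b : a ℕ.< b) cs →
  indices (proj₁ (uncons a<b cs)) ++ coverIndices (proj₂ (uncons a<b cs)) ≡ coverIndices cs
coverIndices-uncons a<a []       = contradiction a<a (ℕₚ.<-irrefl refl)
coverIndices-uncons _   (c ∷ cs) = refl

coverPositive : ∀ {a b} (cs : Cover a b) → Positive (coverIndices cs)
coverPositive []       = positive-[]
coverPositive (c ∷ cs) =
  positive-++ (indices c) _ (λ β β-mono → proj₁ (chainPositive c β β-mono)) (coverPositive cs)

-- The tops of the chains through {1, …, M} are the parts in (M/2, M]. Going from M = 2K + 1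
-- to M + 1 the chain with top K + 1 grows by 2K + 2; going from 2K to 2K + 1 a chain starts.
evenCover      : ∀ K → Cover K (double K)
oddCover       : ∀ K → Cover K (suc (double K))
splitOddCover  : ∀ K → Chain K × Cover (suc K) (suc (double K))

evenCover zero    = []
evenCover (suc K) = proj₂ (splitOddCover K) ∷ʳ twice (proj₁ (splitOddCover K))
oddCover K        = evenCover K ∷ʳ odd K
splitOddCover K   = uncons (s≤s (≤-double K)) (oddCover K)

evenCover-↭ : ∀ K → coverIndices (evenCover K) ↭ downFrom (double K)
oddCover-↭  : ∀ K → coverIndices (oddCover K) ↭ downFrom (suc (double K))

evenCover-↭ zero    = ↭.refl
evenCover-↭ (suc K) = begin
  coverIndices (proj₂ top ∷ʳ twice (proj₁ top))
    ≡⟨ coverIndices-∷ʳ (proj₂ top) (twice (proj₁ top)) ⟩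
  coverIndices (proj₂ top) ++ suc (double K) ∷ indices (proj₁ top)
    ↭⟨ ++-comm (coverIndices (proj₂ top)) _ ⟩
  suc (double K) ∷ indices (proj₁ top) ++ coverIndices (proj₂ top)
    ≡⟨ cong (suc (double K) ∷_) (coverIndices-uncons (s≤s (≤-double K)) (oddCover K)) ⟩
  suc (double K) ∷ coverIndices (oddCover K)
    ↭⟨ ↭.prep (suc (double K)) (oddCover-↭ K) ⟩
  downFrom (double (suc K)) ∎
  where
  open ↭.PermutationReasoning
  top = splitOddCover K

oddCover-↭ K = begin
  coverIndices (evenCover K ∷ʳ odd K)          ≡⟨ coverIndices-∷ʳ (evenCover K) (odd K) ⟩
  coverIndices (evenCover K) ++ double K ∷ []  ↭⟨ ++-comm (coverIndices (evenCover K)) _ ⟩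
  double K ∷ coverIndices (evenCover K)        ↭⟨ ↭.prep (double K) (evenCover-↭ K) ⟩
  downFrom (suc (double K))                    ∎
  where open ↭.PermutationReasoning

even-or-odd : ∀ M → Σ[ K ∈ ℕ ] (M ≡ double K ⊎ M ≡ suc (double K))
even-or-odd zero = 0 , inj₁ refl
even-or-odd (suc M) with even-or-odd M
... | K , inj₁ M≡2K   = K , inj₂ (cong suc M≡2K)
... | K , inj₂ M≡2K+1 = suc K , inj₁ (cong suc M≡2K+1)

positive-downFrom : ∀ M → Positive (downFrom M)
positive-downFrom M with even-or-odd M
... | K , inj₁ refl = positive-↭ (evenCover-↭ K) (coverPositive (evenCover K))
... | K , inj₂ refl = positive-↭ (oddCover-↭ K) (coverPositive (oddCover K))

-- Counting partitions

sum≟ : ∀ n (p : List ℕ) → Dec (sum p ≡ n)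
sum≟ n p = sum p ℕ.≟ n

count : ℕ → List (List ℕ) → ℕ
count n X = length (filter (sum≟ n) X)

count-++ : ∀ n X Y → count n (X ++ Y) ≡ count n X ℕ.+ count n Y
count-++ n X Y = trans (cong length (Listₚ.filter-++ (sum≟ n) X Y)) (Listₚ.length-++ (filter _ X))

count-map-∷ : ∀ a n X → count (n ℕ.+ a) (map (a ∷_) X) ≡ count n X
count-map-∷ a n []      = refl
count-map-∷ a n (p ∷ X) with sum p ℕ.≟ n
... | yes p≡n = trans (cong length (Listₚ.filter-accept (sum≟ (n ℕ.+ a)) {a ∷ p} {map (a ∷_) X}
                                      (trans (cong (a ℕ.+_) p≡n) (ℕₚ.+-comm a n))))
                      (trans (cong suc (count-map-∷ a n X))
                             (cong length (sym (Listₚ.filter-accept (sum≟ n) {p} {X} p≡n))))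
... | no  p≢n = trans (cong length (Listₚ.filter-reject (sum≟ (n ℕ.+ a)) {a ∷ p} {map (a ∷_) X}
                                      (λ e → p≢n (ℕₚ.+-cancelˡ-≡ a _ _ (trans e (ℕₚ.+-comm n a))))))
                      (trans (count-map-∷ a n X)
                             (cong length (sym (Listₚ.filter-reject (sum≟ n) {p} {X} p≢n))))

count-map-∷-< : ∀ a n X → n ℕ.< a → count n (map (a ∷_) X) ≡ 0
count-map-∷-< a n []      n<a = refl
count-map-∷-< a n (p ∷ X) n<a =
  trans (cong length (Listₚ.filter-reject (sum≟ n) {a ∷ p} {map (a ∷_) X}
                       (λ e → ℕₚ.<⇒≱ n<a (subst (a ℕ.≤_) e (ℕₚ.m≤m+n a (sum p))))))
        (count-map-∷-< a n X n<a)

c-suc : ∀ m i n → c (suc m) (suc i) n ≡ count n (map (suc m ∷_) (decLists (suc m) i)) ℕ.+ c m (suc i) n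
c-suc m i n = count-++ n (map (suc m ∷_) (decLists (suc m) i)) (decLists m (suc i))

c-< : ∀ m i n → n ℕ.< suc m → c (suc m) i n ≡ c m i n
c-< m zero    n n<m = refl
c-< m (suc i) n n<m =
  trans (c-suc m i n) (cong (ℕ._+ c m (suc i) n) (count-map-∷-< (suc m) n (decLists (suc m) i) n<m))

c-+ : ∀ m i j → c (suc m) (suc i) (j ℕ.+ suc m) ≡ c (suc m) i j ℕ.+ c m (suc i) (j ℕ.+ suc m)
c-+ m i j =
  trans (c-suc m i _) (cong (ℕ._+ c m (suc i) (j ℕ.+ suc m)) (count-map-∷ (suc m) j (decLists (suc m) i)))

c-vanish : ∀ m i n → n ℕ.< i → c m i n ≡ 0
c-vanish zero    (suc i) n n<i = refl
c-vanish (suc m) (suc i) n n<i with <-or-+ (suc m) n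
... | inj₁ n<m        = trans (c-< m (suc i) n n<m) (c-vanish m (suc i) n n<i)
... | inj₂ (j , refl) = trans (c-+ m i j) (cong₂ ℕ._+_ (c-vanish (suc m) i j j<i) (c-vanish m (suc i) _ n<i))
  where
  j<i : j ℕ.< i
  j<i = ℕₚ.≤-trans (ℕₚ.m<m+n j (s≤s z≤n)) (ℕₚ.≤-pred n<i)

sumBelow : ℕ → (ℕ → ℤ) → ℤ
sumBelow zero    g = + 0
sumBelow (suc N) g = g 0 + sumBelow N (λ i → g (suc i))

foldr-applyUpTo : ∀ (g : ℕ → ℤ) f N →
                  foldr _+_ (+ 0) (map g (applyUpTo f N)) ≡ sumBelow N (λ i → g (f i))
foldr-applyUpTo g f zero    = refl
foldr-applyUpTo g f (suc N) = cong (_+_ (g (f 0))) (foldr-applyUpTo g (λ i → f (suc i)) N)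

sumBelow-cong : ∀ N {g h} → (∀ i → g i ≡ h i) → sumBelow N g ≡ sumBelow N h
sumBelow-cong zero    g≗h = refl
sumBelow-cong (suc N) g≗h = cong₂ _+_ (g≗h 0) (sumBelow-cong N (λ i → g≗h (suc i)))

sumBelow-+ : ∀ N g h → sumBelow N (λ i → g i + h i) ≡ sumBelow N g + sumBelow N h
sumBelow-+ zero    g h = refl
sumBelow-+ (suc N) g h = trans (cong (_+_ (g 0 + h 0)) (sumBelow-+ N _ _)) (interchange (g 0) (h 0) _ _)
  where
  interchange : ∀ a b c d → (a + b) + (c + d) ≡ (a + c) + (b + d)
  interchange = solve-∀

sumBelow-zero : ∀ N → sumBelow N (λ _ → + 0) ≡ + 0
sumBelow-zero zero    = refl
sumBelow-zero (suc N) = trans (ℤₚ.+-identityˡ _) (sumBelow-zero N)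

sumBelow-+-vanishing : ∀ N d g → (∀ i → N ℕ.≤ i → g i ≡ + 0) → sumBelow (N ℕ.+ d) g ≡ sumBelow N g
sumBelow-+-vanishing zero    d g g≡0 = trans (sumBelow-cong d (λ i → g≡0 i z≤n)) (sumBelow-zero d)
sumBelow-+-vanishing (suc N) d g g≡0 =
  cong (_+_ (g 0)) (sumBelow-+-vanishing N d _ (λ i N≤i → g≡0 (suc i) (s≤s N≤i)))

-- Coefficient of qⁿ in Π_{p ≤ m} 1/(1 − w qᵖ), with wⁱ read as g (L + i).
partitionSeries : ℕ → (ℕ → ℤ) → Series
partitionSeries m g n L = sumBelow (suc n) (λ i → + c m i n * g (L ℕ.+ i))

partitionSeries-rec : ∀ m g → partitionSeries (suc m) g ≈
  λ n L → partitionSeries m g n L + shift (suc m) (partitionSeries (suc m) g) n L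
partitionSeries-rec m g n L with <-or-+ (suc m) n
... | inj₁ n<m = trans (sumBelow-cong (suc n) (λ i → cong (λ x → + x * g (L ℕ.+ i)) (c-< m i n n<m)))
                       (sym (trans (cong (_+_ (partitionSeries m g n L)) (shift-< (suc m) _ L n<m))
                                   (ℤₚ.+-identityʳ _)))
... | inj₂ (j , refl) = begin
  first + sumBelow N (λ i → + c (suc m) (suc i) N * g (L ℕ.+ suc i))
    ≡⟨ cong (_+_ first) (trans (sumBelow-cong N term-split) (sumBelow-+ N _ _)) ⟩
  first + (sumBelow N (λ i → + c m (suc i) N * g (L ℕ.+ suc i)) + sumBelow N larger)
    ≡⟨ ℤₚ.+-assoc first (sumBelow N (λ i → + c m (suc i) N * g (L ℕ.+ suc i))) (sumBelow N larger) ⟨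
  partitionSeries m g N L + sumBelow N larger
    ≡⟨ cong (_+_ (partitionSeries m g N L)) (trans (cong (λ M → sumBelow M larger) (ℕₚ.+-suc j m))
                                                   (sumBelow-+-vanishing (suc j) m larger larger≡0)) ⟩
  partitionSeries m g N L + partitionSeries (suc m) g j (suc L)
    ≡⟨ cong (_+_ (partitionSeries m g N L)) (shift-+ (suc m) (partitionSeries (suc m) g) j L) ⟨
  partitionSeries m g N L + shift (suc m) (partitionSeries (suc m) g) N L ∎
  where
  open ≡-Reasoning
  N = j ℕ.+ suc m
  first = + c m 0 N * g (L ℕ.+ 0)
  larger : ℕ → ℤ
  larger i = + c (suc m) i j * g (suc L ℕ.+ i)
  term-split : ∀ i → + c (suc m) (suc i) N * g (L ℕ.+ suc i) ≡ + c m (suc i) N * g (L ℕ.+ suc i) + larger i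
  term-split i = begin
    + c (suc m) (suc i) N * g (L ℕ.+ suc i)
      ≡⟨ cong (λ x → + x * g (L ℕ.+ suc i))
              (trans (c-+ m i j) (ℕₚ.+-comm (c (suc m) i j) (c m (suc i) N))) ⟩
    + (c m (suc i) N ℕ.+ c (suc m) i j) * g (L ℕ.+ suc i)
      ≡⟨ cong (_* g (L ℕ.+ suc i)) (ℤₚ.pos-+ (c m (suc i) N) (c (suc m) i j)) ⟩
    (+ c m (suc i) N + + c (suc m) i j) * g (L ℕ.+ suc i)
      ≡⟨ ℤₚ.*-distribʳ-+ (g (L ℕ.+ suc i)) (+ c m (suc i) N) (+ c (suc m) i j) ⟩
    + c m (suc i) N * g (L ℕ.+ suc i) + + c (suc m) i j * g (L ℕ.+ suc i)
      ≡⟨ cong (λ x → + c m (suc i) N * g (L ℕ.+ suc i) + + c (suc m) i j * g x) (ℕₚ.+-suc L i) ⟩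
    + c m (suc i) N * g (L ℕ.+ suc i) + larger i ∎
  larger≡0 : ∀ i → suc j ℕ.≤ i → larger i ≡ + 0
  larger≡0 i j<i = cong (λ x → + x * g (suc L ℕ.+ i)) (c-vanish (suc m) i j j<i)

-- Multiplying the coefficient of qⁿ wⁱ by (−1)^(n+i) turns 1/(1 − w qᵖ) into 1/(1 − (−1)^(p+1) w qᵖ).
twist : Series → Series
twist X n L = sgn n * (sgn L * X n L)

twist-geometricEq : ∀ a γ X → X ≈ (λ n L → γ n L + shift (suc a) X n L) →
                    GeometricEq a (twist γ) (twist X)
twist-geometricEq a γ X eq n L with <-or-+ (suc a) n
... | inj₁ n<a = begin
  sgn n * (sgn L * X n L)
    ≡⟨ cong (λ x → sgn n * (sgn L * x)) (eq n L) ⟩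
  sgn n * (sgn L * (γ n L + shift (suc a) X n L))
    ≡⟨ cong (λ x → sgn n * (sgn L * (γ n L + x))) (shift-< (suc a) X L n<a) ⟩
  sgn n * (sgn L * (γ n L + + 0))
    ≡⟨ drop-zero (sgn n) (sgn L) (γ n L) (sgn a) ⟩
  twist γ n L + sgn a * + 0
    ≡⟨ cong (λ x → twist γ n L + sgn a * x) (shift-< (suc a) (twist X) L n<a) ⟨
  twist γ n L + sgn a * shift (suc a) (twist X) n L ∎
  where
  open ≡-Reasoning
  drop-zero : ∀ sn sL g s → sn * (sL * (g + + 0)) ≡ sn * (sL * g) + s * + 0
  drop-zero = solve-∀
... | inj₂ (j , refl) = begin
  sgn N * (sgn L * X N L)
    ≡⟨ cong (λ x → sgn N * (sgn L * x)) (trans (eq N L) (cong (_+_ (γ N L)) (shift-+ (suc a) X j L))) ⟩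
  sgn N * (sgn L * (γ N L + X j (suc L)))
    ≡⟨ regroup (sgn N) (sgn j) (sgn a) (sgn L) (γ N L) (X j (suc L)) (sgn-+ j (suc a)) ⟩
  twist γ N L + sgn a * twist X j (suc L)
    ≡⟨ cong (λ x → twist γ N L + sgn a * x) (shift-+ (suc a) (twist X) j L) ⟨
  twist γ N L + sgn a * shift (suc a) (twist X) N L ∎
  where
  open ≡-Reasoning
  N = j ℕ.+ suc a
  regroup : ∀ sN sj sa sL g x → sN ≡ sj * - sa → sN * (sL * (g + x)) ≡ sN * (sL * g) + sa * (sj * (- sL * x))
  regroup _ sj sa sL g x refl = expand sj sa sL g x
    where
    expand : ∀ sj sa sL g x → (sj * - sa) * (sL * (g + x)) ≡ (sj * - sa) * (sL * g) + sa * (sj * (- sL * x))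
    expand = solve-∀

signedPower : ℕ → ℕ → ℤ
signedPower k x = sgn x * + (x ^ k)

powers : ℕ → Series
powers k zero    L = + (L ^ k)
powers k (suc n) L = + 0

powers-absolutelyMonotone : ∀ k n → AbsolutelyMonotone (powers k n)
powers-absolutelyMonotone k zero    = absolutelyMonotone-^ k
powers-absolutelyMonotone k (suc n) = absolutelyMonotone-0

twist-partitionSeries-0 : ∀ k → twist (partitionSeries 0 (signedPower k)) ≈ powers k
twist-partitionSeries-0 k zero L = begin
  + 1 * (sgn L * (+ 1 * (sgn (L ℕ.+ 0) * + ((L ℕ.+ 0) ^ k)) + + 0))
    ≡⟨ cong (λ l → + 1 * (sgn L * (+ 1 * (sgn l * + (l ^ k)) + + 0))) (ℕₚ.+-identityʳ L) ⟩
  + 1 * (sgn L * (+ 1 * (sgn L * + (L ^ k)) + + 0))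
    ≡⟨ square (sgn L) (+ (L ^ k)) ⟩
  (sgn L * sgn L) * + (L ^ k)
    ≡⟨ trans (cong (_* + (L ^ k)) (sgn-*-sgn L)) (ℤₚ.*-identityˡ _) ⟩
  + (L ^ k) ∎
  where
  open ≡-Reasoning
  square : ∀ s p → + 1 * (s * (+ 1 * (s * p) + + 0)) ≡ (s * s) * p
  square = solve-∀
twist-partitionSeries-0 k (suc n) L =
  trans (cong (λ x → sgn (suc n) * (sgn L * x)) (trans (ℤₚ.+-identityˡ _) (sumBelow-zero (suc n))))
        (trans (cong (sgn (suc n) *_) (ℤₚ.*-zeroʳ (sgn L))) (ℤₚ.*-zeroʳ (sgn (suc n))))

twist-partitionSeries : ∀ k m → twist (partitionSeries m (signedPower k)) ≈ geometrics (downFrom m) (powers k)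
twist-partitionSeries k zero    = twist-partitionSeries-0 k
twist-partitionSeries k (suc m) n L =
  trans (geometric-unique m _ _ (twist-geometricEq m _ _ (partitionSeries-rec m (signedPower k))) n L)
        (geometric-cong m (twist-partitionSeries k m) n L)

S-partitionSeries : ∀ m k n → sgn n * S m k n ≡ twist (partitionSeries m (signedPower k)) n 0
S-partitionSeries m k n = cong (sgn n *_) (begin
  S m k n
    ≡⟨ foldr-applyUpTo (λ i → sgn i * + (i ^ k ℕ.* c m i n)) (λ i → i) (suc n) ⟩
  sumBelow (suc n) (λ i → sgn i * + (i ^ k ℕ.* c m i n))
    ≡⟨ sumBelow-cong (suc n) (λ i → trans (cong (sgn i *_) (ℤₚ.pos-* (i ^ k) (c m i n)))
                                          (reorder (sgn i) (+ (i ^ k)) (+ c m i n))) ⟩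
  partitionSeries m (signedPower k) n 0
    ≡⟨ ℤₚ.*-identityˡ _ ⟨
  + 1 * partitionSeries m (signedPower k) n 0 ∎)
  where
  open ≡-Reasoning
  reorder : ∀ s p x → s * (p * x) ≡ x * (s * p)
  reorder = solve-∀

mainTheorem7 : (m : ℕ) → (k n : ℕ) → + 0 ≤ sgn n * S (suc m) k n
mainTheorem7 m k n =
  subst (+ 0 ≤_) (sym (trans (S-partitionSeries (suc m) k n) (twist-partitionSeries k (suc m) n 0)))
    (positive-downFrom (suc m) (powers k) (powers-absolutelyMonotone k) n 0)
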